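{- Let $H$ be any graph for which $F_e(K_3,K_3;H)$ does not exist. Then for all integers $s > k \geq 3$, $F_e(3,3,k;s) \geq F_e(H,K_k;K_s)$.
   Context: All graphs are finite, undirected and simple. A graph is $H$-free if it contains no subgraph isomorphic to $H$. $F_e(H_1,H_2;H)$ is the smallest $n$ such that there is an $H$-free graph $G$ on $n$ vertices such that every red-blue coloring of the edges of $G$ contains a red subgraph isomorphic to $H_1$ or a blue subgraph isomorphic to $H_2$; it "exists" if such a graph exists. The three-color edge Folkman number $F_e(3,3,k;s)$ is the smallest $n$ such that there is a $K_s$-free graph $G$ on $n$ vertices such that every coloring of the edges of $G$ with colors $1,2,3$ contains a triangle in color $1$, a triangle in color $2$, or a $K_k$ in color $3$ (this number is known to exist for $s > k \ge 3$). -}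

module Defs where

open import Data.Nat using (ℕ; _≤_)
open import Data.Fin using (Fin; zero; suc; _≟_)
open import Data.Bool using (Bool; true; false; not)
open import Data.Product using (Σ; _×_; ∃)
open import Data.Sum using (_⊎_)
open import Relation.Nullary using (¬_; yes; no)
open import Data.Empty using (⊥-elim)
open import Relation.Nullary.Decidable using (⌊_⌋)
open import Relation.Binary.PropositionalEquality using (_≡_; refl) renaming (sym to ≡-sym)
open import Function.Definitions using (Injective)

record Graph (n : ℕ) : Set where
  field
    adj    : Fin n → Fin n → Bool
    sym    : ∀ i j → adj i j ≡ adj j i
    irrefl : ∀ i → adj i i ≡ false
open Graph public

K : (k : ℕ) → Graph k
K k = record { adj = λ i j → not ⌊ i ≟ j ⌋ ; sym = symK ; irrefl = irrK }
  where
  symK : ∀ (i j : Fin k) → not ⌊ i ≟ j ⌋ ≡ not ⌊ j ≟ i ⌋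
  symK i j with i ≟ j | j ≟ i
  ... | yes _ | yes _ = refl
  ... | yes p | no q = ⊥-elim (q (≡-sym p))
  ... | no p | yes q = ⊥-elim (p (≡-sym q))
  ... | no _ | no _ = refl
  irrK : ∀ (i : Fin k) → not ⌊ i ≟ i ⌋ ≡ false
  irrK i with i ≟ i
  ... | yes _ = refl
  ... | no p = ⊥-elim (p refl)

Contains : ∀ {h n} → Graph n → Graph h → Set
Contains {h} {n} G H =
  Σ (Fin h → Fin n) λ f → Injective _≡_ _≡_ f ×
    (∀ i j → adj H i j ≡ true → adj G (f i) (f j) ≡ true)

Free : ∀ {h n} → Graph h → Graph n → Set
Free H G = ¬ Contains G H

-- An edge colouring of G with colours C: a symmetric function on vertex pairs
-- (only its values on edges of G matter).
Symmetric : ∀ {n} {C : Set} → (Fin n → Fin n → C) → Set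
Symmetric {n} c = ∀ (i j : Fin n) → c i j ≡ c j i

ContainsIn : ∀ {h n} {C : Set} → Graph n → (Fin n → Fin n → C) → C → Graph h → Set
ContainsIn {h} {n} G c col H =
  Σ (Fin h → Fin n) λ f → Injective _≡_ _≡_ f ×
    (∀ i j → adj H i j ≡ true → (adj G (f i) (f j) ≡ true) × (c (f i) (f j) ≡ col))

-- Every red(=true)/blue(=false) colouring of G has a red H1 or a blue H2.
Arrows2 : ∀ {n h1 h2} → Graph n → Graph h1 → Graph h2 → Set
Arrows2 {n} G H1 H2 =
  (c : Fin n → Fin n → Bool) → Symmetric c →
  ContainsIn G c true H1 ⊎ ContainsIn G c false H2

-- Witness for F_e(H1,H2;H) ≤ n : an H-free graph on n vertices arrowing (H1,H2).
FeWitness : ∀ {h1 h2 h} → Graph h1 → Graph h2 → Graph h → ℕ → Set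
FeWitness H1 H2 H n = Σ (Graph n) λ G → Free H G × Arrows2 G H1 H2

FeExists : ∀ {h1 h2 h} → Graph h1 → Graph h2 → Graph h → Set
FeExists H1 H2 H = ∃ λ n → FeWitness H1 H2 H n

Arrows3 : ∀ {n} → Graph n → ℕ → Set
Arrows3 {n} G k =
  (c : Fin n → Fin n → Fin 3) → Symmetric c →
  ContainsIn G c zero (K 3) ⊎ ContainsIn G c (suc zero) (K 3) ⊎ ContainsIn G c (suc (suc zero)) (K k)

-- Witness for F_e(3,3,k;s) ≤ n.
Fe3Witness : ℕ → ℕ → ℕ → Set
Fe3Witness k s n = Σ (Graph n) λ G → Free (K s) G × Arrows3 G k

IsLeast : (ℕ → Set) → ℕ → Set
IsLeast P n = P n × (∀ m → P m → n ≤ m)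

-- If c colours G (K_s-free, arrowing (3,3,k)) without a red H, the red subgraph is H-free;
-- as F_e(K_3,K_3;H) does not exist, it has a red/blue colouring d without monochromatic
-- triangles. Splitting the red edges of G by d and giving the blue edges the third colour
-- yields a 3-colouring whose only possible monochromatic K_k is blue in c. So G witnesses
-- F_e(H,K_k;K_s) ≤ n. Constructively, both d and the least witness are found by exhaustive
-- search, which is why the arrowing and freeness predicates are shown decidable.
module Submission where

open import Defs
open import Level using (0ℓ)
open import Data.Nat using (ℕ; zero; suc; _≤_; _<_)
open import Data.Nat.Properties using (≤-refl; ≤-trans; <⇒≤; ≮⇒≥; anyUpTo?)
open import Data.Nat.Induction using (<-rec)
open import Data.Bool using (Bool; true; false; _∧_)
open import Data.Bool.Properties using () renaming (_≟_ to _≟ᵇ_)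
open import Data.Fin using (Fin; zero; suc)
open import Data.Fin.Properties using (any?; all?) renaming (_≟_ to _≟ᶠ_)
open import Data.Empty using (⊥-elim)
open import Data.Product as Product using (Σ; ∃; _×_; _,_)
open import Data.Sum as Sum using (_⊎_; inj₁; inj₂; [_,_]; [_,_]′)
open import Data.Vec.Functional using (Vector; _∷_; head; tail)
import Data.Vec.Functional.Relation.Binary.Pointwise.Properties as Pointwise
open import Function.Base using (id; _∘_)
open import Function.Definitions using (Injective)
open import Relation.Binary.Bundles using (Setoid)
open import Relation.Binary.Core using (_⇒_)
open import Relation.Binary.Definitions using (_Respects_; DecidableEquality)
import Relation.Binary.Construct.On as On
open import Relation.Binary.PropositionalEquality as ≡ using (_≡_; _≗_; refl; trans; cong; cong₂; subst₂)
open import Relation.Nullary using (¬_; Dec; yes; no)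
open import Relation.Nullary.Decidable using (map′; ¬?; _×-dec_; _⊎-dec_; _→-dec_)
open import Relation.Unary using (Pred; Decidable)

-- Functions are searched up to pointwise equality, as they cannot be identified without
-- function extensionality.
Exhaustible : Setoid 0ℓ 0ℓ → Set₁
Exhaustible S = ∀ {P : Pred Carrier 0ℓ} → P Respects _≈_ → Decidable P → Dec (∃ P)
  where open Setoid S

exhaustible-Fin : ∀ n → Exhaustible (≡.setoid (Fin n))
exhaustible-Fin n _ P? = any? P?

exhaustible-Bool : Exhaustible (≡.setoid Bool)
exhaustible-Bool {P} _ P? = map′ [ (true ,_) , (false ,_) ] split (P? true ⊎-dec P? false)
  where
  split : ∃ P → P true ⊎ P false
  split (true , p) = inj₁ p
  split (false , p) = inj₂ p

module _ {S : Setoid 0ℓ 0ℓ} where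
  open Setoid S using (Carrier; _≈_) renaming (refl to ≈-refl)
  open import Data.Vec.Functional.Relation.Binary.Equality.Setoid S using (_≋_; ≋-refl)

  ∷-cong : ∀ {n x y} {xs ys : Vector Carrier n} → x ≈ y → xs ≋ ys → (x ∷ xs) ≋ (y ∷ ys)
  ∷-cong x≈y xs≋ys zero = x≈y
  ∷-cong x≈y xs≋ys (suc i) = xs≋ys i

  head∷tail : ∀ {n} (xs : Vector Carrier (suc n)) → xs ≋ (head xs ∷ tail xs)
  head∷tail xs zero = ≈-refl
  head∷tail xs (suc i) = ≈-refl

  exhaustible-Vector : Exhaustible S → ∀ n → Exhaustible (Pointwise.setoid S n)
  exhaustible-Vector _ zero resp P? =
    map′ (λ p → _ , p) (λ (xs , p) → resp {xs} (λ ()) p) (P? (λ ()))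
  exhaustible-Vector ∃? (suc n) resp P? =
    map′ (λ (x , xs , p) → x ∷ xs , p)
         (λ (xs , p) → head xs , tail xs , resp (head∷tail xs) p)
         (∃? (λ x≈y (xs , p) → xs , resp (∷-cong x≈y ≋-refl) p)
             (λ x → exhaustible-Vector ∃? n (λ xs≋ys → resp (∷-cong ≈-refl xs≋ys))
                                               (λ xs → P? (x ∷ xs))))

_≗₂_ : {A B C : Set} → (A → B → C) → (A → B → C) → Set
f ≗₂ g = ∀ x y → f x y ≡ g x y

≗₂-refl : {A B C : Set} (f : A → B → C) → f ≗₂ f
≗₂-refl f x y = refl

≗₂-sym : {A B C : Set} {f g : A → B → C} → f ≗₂ g → g ≗₂ f
≗₂-sym f≗g x y = ≡.sym (f≗g x y)

square-setoid : ℕ → Setoid 0ℓ 0ℓ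
square-setoid n = Pointwise.setoid (Pointwise.setoid (≡.setoid Bool) n) n

exhaustible-square : ∀ n → Exhaustible (square-setoid n)
exhaustible-square n = exhaustible-Vector {Pointwise.setoid (≡.setoid Bool) n}
  (exhaustible-Vector {≡.setoid Bool} exhaustible-Bool n) n

graph-setoid : ℕ → Setoid 0ℓ 0ℓ
graph-setoid n = On.setoid {B = Graph n} (square-setoid n) adj

symmetric? : ∀ {n} {C : Set} → DecidableEquality C → (c : Fin n → Fin n → C) → Dec (Symmetric c)
symmetric? _≟_ c = all? λ i → all? λ j → c i j ≟ c j i

Symmetric-resp : ∀ {n} {C : Set} {c c′ : Fin n → Fin n → C} → c ≗₂ c′ → Symmetric c → Symmetric c′
Symmetric-resp c≗c′ sc i j = trans (≡.sym (c≗c′ i j)) (trans (sc i j) (c≗c′ j i))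

exhaustible-Graph : ∀ n → Exhaustible (graph-setoid n)
exhaustible-Graph n {P} resp P? =
  map′ (λ (a , s , ir , p) → graph a s ir , p) toMatrix (exhaustible-square n resp′ GraphWith?)
  where
  graph : (a : Fin n → Fin n → Bool) → Symmetric a → (∀ i → a i i ≡ false) → Graph n
  graph a s ir = record { adj = a ; sym = s ; irrefl = ir }
  GraphWith : (Fin n → Fin n → Bool) → Set
  GraphWith a = Σ (Symmetric a) λ s → Σ (∀ i → a i i ≡ false) λ ir → P (graph a s ir)
  toMatrix : ∃ P → ∃ GraphWith
  toMatrix (G , p) = adj G , sym G , irrefl G , p
  resp′ : GraphWith Respects (Setoid._≈_ (square-setoid n))
  resp′ a≗b (s , ir , p) =
    Symmetric-resp a≗b s , (λ i → trans (≡.sym (a≗b i i)) (ir i)) , resp a≗b p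
  GraphWith? : Decidable GraphWith
  GraphWith? a with symmetric? _≟ᵇ_ a | all? (λ i → a i i ≟ᵇ false)
  ... | no ¬s | _ = no λ (s , _) → ¬s s
  ... | yes _ | no ¬ir = no λ (_ , ir , _) → ¬ir ir
  ... | yes s | yes ir =
    map′ (λ p → s , ir , p) (λ (_ , _ , p) → resp (≗₂-refl a) p) (P? (graph a s ir))

-- Contains G H and ContainsIn G c col H unfold to EmbedsInto H (Edge G) and
-- EmbedsInto H (ColouredEdge G c col), so both are handled at once.
IsEmbeddingInto : ∀ {h n} → Graph h → (Fin n → Fin n → Set) → (Fin h → Fin n) → Set
IsEmbeddingInto H Q f = Injective _≡_ _≡_ f × (∀ i j → adj H i j ≡ true → Q (f i) (f j))

EmbedsInto : ∀ {h n} → Graph h → (Fin n → Fin n → Set) → Set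
EmbedsInto H Q = ∃ (IsEmbeddingInto H Q)

Edge : ∀ {n} → Graph n → Fin n → Fin n → Set
Edge G x y = adj G x y ≡ true

ColouredEdge : ∀ {n} {C : Set} → Graph n → (Fin n → Fin n → C) → C → Fin n → Fin n → Set
ColouredEdge G c col x y = Edge G x y × c x y ≡ col

EmbedsInto-mono : ∀ {h n} {H : Graph h} {Q Q′ : Fin n → Fin n → Set} →
  Q ⇒ Q′ → EmbedsInto H Q → EmbedsInto H Q′
EmbedsInto-mono Q⇒Q′ (f , f-inj , f-hom) = f , f-inj , λ i j e → Q⇒Q′ (f-hom i j e)

injective? : ∀ {m n} (f : Fin m → Fin n) → Dec (Injective _≡_ _≡_ f)
injective? f = map′ (λ inj → inj _ _) (λ inj _ _ → inj)
  (all? λ x → all? λ y → f x ≟ᶠ f y →-dec x ≟ᶠ y)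

embedsInto? : ∀ {h n} {Q : Fin n → Fin n → Set} → (∀ x y → Dec (Q x y)) →
  (H : Graph h) → Dec (EmbedsInto H Q)
embedsInto? {h} {n} {Q} Q? H =
  exhaustible-Vector {≡.setoid (Fin n)} (exhaustible-Fin n) h resp
    (λ f → injective? f ×-dec all? λ i → all? λ j → adj H i j ≟ᵇ true →-dec Q? (f i) (f j))
  where
  resp : IsEmbeddingInto H Q Respects _≗_
  resp f≗g (f-inj , f-hom) =
    (λ {x} {y} gx≡gy → f-inj (trans (f≗g x) (trans gx≡gy (≡.sym (f≗g y))))) ,
    λ i j e → subst₂ Q (f≗g i) (f≗g j) (f-hom i j e)

containsIn? : ∀ {h n} (G : Graph n) (c : Fin n → Fin n → Bool) col (H : Graph h) →
  Dec (ContainsIn G c col H)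
containsIn? G c col = embedsInto? λ x y → adj G x y ≟ᵇ true ×-dec c x y ≟ᵇ col

contains? : ∀ {h n} (G : Graph n) (H : Graph h) → Dec (Contains G H)
contains? G = embedsInto? {Q = Edge G} λ x y → adj G x y ≟ᵇ true

ContainsIn-resp : ∀ {h n} (H : Graph h) (G G′ : Graph n) {c c′ : Fin n → Fin n → Bool} {col} →
  adj G ≗₂ adj G′ → c ≗₂ c′ → ContainsIn G c col H → ContainsIn G′ c′ col H
ContainsIn-resp H G G′ {c} {c′} {col} G≗G′ c≗c′ =
  EmbedsInto-mono {H = H} {ColouredEdge G c col} {ColouredEdge G′ c′ col} λ {x} {y} (e , p) →
    trans (≡.sym (G≗G′ x y)) e , trans (≡.sym (c≗c′ x y)) p

Free-resp : ∀ {h n} (H : Graph h) (G G′ : Graph n) → adj G ≗₂ adj G′ → Free H G → Free H G′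
Free-resp H G G′ G≗G′ free =
  free ∘ EmbedsInto-mono {H = H} {Edge G′} {Edge G} λ {x} {y} e → trans (G≗G′ x y) e

Arrows2-resp : ∀ {n h₁ h₂} (H₁ : Graph h₁) (H₂ : Graph h₂) (G G′ : Graph n) →
  adj G ≗₂ adj G′ → Arrows2 G H₁ H₂ → Arrows2 G′ H₁ H₂
Arrows2-resp H₁ H₂ G G′ G≗G′ arrows c sc =
  Sum.map (ContainsIn-resp H₁ G G′ G≗G′ (≗₂-refl c)) (ContainsIn-resp H₂ G G′ G≗G′ (≗₂-refl c))
    (arrows c sc)

AvoidingColouring : ∀ {n h₁ h₂} → Graph n → Graph h₁ → Graph h₂ → (Fin n → Fin n → Bool) → Set
AvoidingColouring G H₁ H₂ c =
  Symmetric c × ¬ ContainsIn G c true H₁ × ¬ ContainsIn G c false H₂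

AvoidingColouring-resp : ∀ {n h₁ h₂} (G : Graph n) (H₁ : Graph h₁) (H₂ : Graph h₂) →
  AvoidingColouring G H₁ H₂ Respects Setoid._≈_ (square-setoid n)
AvoidingColouring-resp G H₁ H₂ c≗c′ (sc , ¬red , ¬blue) =
  Symmetric-resp c≗c′ sc ,
  ¬red ∘ ContainsIn-resp H₁ G G (≗₂-refl (adj G)) (≗₂-sym c≗c′) ,
  ¬blue ∘ ContainsIn-resp H₂ G G (≗₂-refl (adj G)) (≗₂-sym c≗c′)

avoidingColouring? : ∀ {n h₁ h₂} (G : Graph n) (H₁ : Graph h₁) (H₂ : Graph h₂) →
  Decidable (AvoidingColouring G H₁ H₂)
avoidingColouring? G H₁ H₂ c =
  symmetric? _≟ᵇ_ c ×-dec ¬? (containsIn? G c true H₁) ×-dec ¬? (containsIn? G c false H₂)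

Arrows2⊎avoiding : ∀ {n h₁ h₂} (G : Graph n) (H₁ : Graph h₁) (H₂ : Graph h₂) →
  Arrows2 G H₁ H₂ ⊎ ∃ (AvoidingColouring G H₁ H₂)
Arrows2⊎avoiding {n} G H₁ H₂
  with exhaustible-square n (AvoidingColouring-resp G H₁ H₂) (avoidingColouring? G H₁ H₂)
... | yes avoiding = inj₂ avoiding
... | no ¬avoiding = inj₁ arrows
  where
  arrows : Arrows2 G H₁ H₂
  arrows c sc with containsIn? G c true H₁ | containsIn? G c false H₂
  ... | yes red | _ = inj₁ red
  ... | no _ | yes blue = inj₂ blue
  ... | no ¬red | no ¬blue = ⊥-elim (¬avoiding (c , sc , ¬red , ¬blue))

arrows2? : ∀ {n h₁ h₂} (G : Graph n) (H₁ : Graph h₁) (H₂ : Graph h₂) → Dec (Arrows2 G H₁ H₂)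
arrows2? G H₁ H₂ with Arrows2⊎avoiding G H₁ H₂
... | inj₁ arrows = yes arrows
... | inj₂ (c , sc , ¬red , ¬blue) = no λ arrows → [ ¬red , ¬blue ] (arrows c sc)

feWitness? : ∀ {h₁ h₂ h} (H₁ : Graph h₁) (H₂ : Graph h₂) (H : Graph h) →
  Decidable (FeWitness H₁ H₂ H)
feWitness? H₁ H₂ H n =
  exhaustible-Graph n (λ {G} {G′} → resp {G} {G′}) λ G → ¬? (contains? G H) ×-dec arrows2? G H₁ H₂
  where
  resp : (λ G → Free H G × Arrows2 G H₁ H₂) Respects Setoid._≈_ (graph-setoid n)
  resp {G} {G′} G≗G′ = Product.map (Free-resp H G G′ G≗G′) (Arrows2-resp H₁ H₂ G G′ G≗G′)

redSubgraph : ∀ {n} (G : Graph n) (c : Fin n → Fin n → Bool) → Symmetric c → Graph n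
redSubgraph G c sc = record
  { adj = λ x y → adj G x y ∧ c x y
  ; sym = λ x y → cong₂ _∧_ (sym G x y) (sc x y)
  ; irrefl = λ x → cong (_∧ c x x) (irrefl G x)
  }

∧≡true⁻ : ∀ a b → a ∧ b ≡ true → a ≡ true × b ≡ true
∧≡true⁻ true true _ = refl , refl

redSubgraph-free : ∀ {h n} (H : Graph h) (G : Graph n) {c} (sc : Symmetric c) →
  ¬ ContainsIn G c true H → Free H (redSubgraph G c sc)
redSubgraph-free H G {c} sc ¬red H⊆R =
  ¬red (EmbedsInto-mono {H = H} {Edge (redSubgraph G c sc)} {ColouredEdge G c true}
          (λ {x} {y} → ∧≡true⁻ (adj G x y) (c x y)) H⊆R)

refine : Bool → Bool → Fin 3
refine true true = zero
refine true false = suc zero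
refine false _ = suc (suc zero)

refine≡0⁻ : ∀ a b → refine a b ≡ zero → a ≡ true × b ≡ true
refine≡0⁻ true true _ = refl , refl

refine≡1⁻ : ∀ a b → refine a b ≡ suc zero → a ≡ true × b ≡ false
refine≡1⁻ true false _ = refl , refl

refine≡2⁻ : ∀ a b → refine a b ≡ suc (suc zero) → a ≡ false
refine≡2⁻ false _ _ = refl
refine≡2⁻ true true ()
refine≡2⁻ true false ()

refinement : ∀ {n} → (Fin n → Fin n → Bool) → (Fin n → Fin n → Bool) → Fin n → Fin n → Fin 3
refinement c d x y = refine (c x y) (d x y)

refinement-symmetric : ∀ {n} {c d : Fin n → Fin n → Bool} →
  Symmetric c → Symmetric d → Symmetric (refinement c d)
refinement-symmetric sc sd x y = cong₂ refine (sc x y) (sd x y)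

module _ {n h} (G : Graph n) {c : Fin n → Fin n → Bool} (sc : Symmetric c)
         (d : Fin n → Fin n → Bool) (F : Graph h) where

  private
    RefinedEdge : Fin 3 → Fin n → Fin n → Set
    RefinedEdge = ColouredEdge G (refinement c d)

  ContainsIn-refinement-0 :
    ContainsIn G (refinement c d) zero F → ContainsIn (redSubgraph G c sc) d true F
  ContainsIn-refinement-0 = EmbedsInto-mono {H = F} {RefinedEdge zero} λ {x} {y} (e , p) →
    let c≡true , d≡true = refine≡0⁻ (c x y) (d x y) p in cong₂ _∧_ e c≡true , d≡true

  ContainsIn-refinement-1 :
    ContainsIn G (refinement c d) (suc zero) F → ContainsIn (redSubgraph G c sc) d false F
  ContainsIn-refinement-1 = EmbedsInto-mono {H = F} {RefinedEdge (suc zero)} λ {x} {y} (e , p) →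
    let c≡true , d≡false = refine≡1⁻ (c x y) (d x y) p in cong₂ _∧_ e c≡true , d≡false

  ContainsIn-refinement-2 : ContainsIn G (refinement c d) (suc (suc zero)) F → ContainsIn G c false F
  ContainsIn-refinement-2 = EmbedsInto-mono {H = F} {RefinedEdge (suc (suc zero))} λ {x} {y} (e , p) →
    e , refine≡2⁻ (c x y) (d x y) p

redSubgraph-avoiding⇒blueClique : ∀ {n} (G : Graph n) (k : ℕ) → Arrows3 G k →
  ∀ {c} (sc : Symmetric c) d → AvoidingColouring (redSubgraph G c sc) (K 3) (K 3) d →
  ContainsIn G c false (K k)
redSubgraph-avoiding⇒blueClique G k G→3 {c} sc d (sd , ¬red△ , ¬blue△)
  with G→3 (refinement c d) (refinement-symmetric sc sd)
... | inj₁ △₀ = ⊥-elim (¬red△ (ContainsIn-refinement-0 G sc d (K 3) △₀))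
... | inj₂ (inj₁ △₁) = ⊥-elim (¬blue△ (ContainsIn-refinement-1 G sc d (K 3) △₁))
... | inj₂ (inj₂ blueK) = ContainsIn-refinement-2 G sc d (K k) blueK

¬FeExists∧Free⇒avoiding : ∀ {n h₁ h₂ h} (H₁ : Graph h₁) (H₂ : Graph h₂) (H : Graph h) (G : Graph n) →
  ¬ FeExists H₁ H₂ H → Free H G → ∃ (AvoidingColouring G H₁ H₂)
¬FeExists∧Free⇒avoiding {n} H₁ H₂ H G noFe free =
  [ (λ arrows → ⊥-elim (noFe (n , G , free , arrows))) , id ]′ (Arrows2⊎avoiding G H₁ H₂)

Arrows3⇒Arrows2 : ∀ {h n} (H : Graph h) → ¬ FeExists (K 3) (K 3) H →
  (G : Graph n) (k : ℕ) → Arrows3 G k → Arrows2 G H (K k)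
Arrows3⇒Arrows2 H noFe G k G→3 c sc with containsIn? G c true H
... | yes redH = inj₁ redH
... | no ¬redH =
  let R = redSubgraph G c sc
      d , avoiding = ¬FeExists∧Free⇒avoiding (K 3) (K 3) H R noFe (redSubgraph-free H G sc ¬redH)
  in inj₂ (redSubgraph-avoiding⇒blueClique G k G→3 sc d avoiding)

LeastBelow : (ℕ → Set) → ℕ → Set
LeastBelow P n = Σ ℕ λ m → IsLeast P m × m ≤ n

leastBelow : {P : ℕ → Set} → Decidable P → ∀ {n} → P n → LeastBelow P n
leastBelow {P} P? {n} = <-rec (λ n → P n → LeastBelow P n) step n
  where
  step : ∀ n → (∀ {m} → m < n → P m → LeastBelow P m) → P n → LeastBelow P n
  step n rec Pn with anyUpTo? P? n
  ... | yes (m , m<n , Pm) = let l , least , l≤m = rec m<n Pm in l , least , ≤-trans l≤m (<⇒≤ m<n)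
  ... | no none = n , (Pn , λ m Pm → ≮⇒≥ λ m<n → none (m , m<n , Pm)) , ≤-refl

corollary10 : ∀ {h} (H : Graph h) → ¬ FeExists (K 3) (K 3) H →
    ∀ (s k : ℕ) → 3 ≤ k → k < s →
    ∀ (n : ℕ) → IsLeast (Fe3Witness k s) n →
    Σ ℕ λ m → IsLeast (FeWitness H (K k) (K s)) m × m ≤ n
corollary10 H noFe s k _ _ n ((G , Ks-free , G→3) , _) =
  leastBelow (feWitness? H (K k) (K s)) (G , Ks-free , Arrows3⇒Arrows2 H noFe G k G→3)
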